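{- Let $g:\mathbb{F}_{2^n}\to\mathbb{F}_{2^n}$ be an arbitrary map, $\Pi:\mathbb{F}_{2^n}\to\mathbb{F}_{2^n}$ a map, and define $f:\mathbb{F}_{2^n}\times\mathbb{F}_{2^n}\to\mathbb{F}_{2^n}$ by $f(x,y)=x\Pi(y)+g(y)$. Then every component function of $f$ is shifted-bent with respect to an arbitrary subset $\Lambda$ of the indices of the coordinates $y_0,\dots,y_{n-1}$ of $y$ if and only if $\Pi$ is a permutation of $\mathbb{F}_{2^n}$.
   Context: Fix an $\mathbb{F}_2$-basis of $\mathbb{F}_{2^n}$ and identify $\mathbb{F}_{2^n}$ with $\mathbb{F}_2^n$ via coordinates; $(x,y)$ has coordinates $x_0,\dots,x_{n-1},y_0,\dots,y_{n-1}$. A component function of $f$ is a nonzero $\mathbb{F}_2$-linear combination of its coordinate functions (equivalently $(x,y)\mapsto\mathrm{Tr}(\lambda f(x,y))$ for $\lambda\neq0$). A Boolean function $F:\mathbb{F}_2^m\to\mathbb{F}_2$ is balanced if it takes values $0$ and $1$ equally often, and shifted-bent with respect to $\Lambda\subseteq\{0,\dots,m-1\}$ if for every nonzero $a\in\mathbb{F}_2^m$ the function $z\mapsto F(z+a)+F(z)+\sum_{i\in\Lambda}z_ia_i$ is balanced. -}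

module Defs where

open import Data.Nat using (ℕ; _+_)
open import Data.Bool using (Bool; true; false; _xor_; _∧_; not)
open import Data.Vec using (Vec; []; _∷_; zipWith; replicate; _++_; map; foldr; splitAt)
open import Data.List using (List; []; _∷_; length; filter; concatMap) renaming (map to lmap; _++_ to _+++_)
open import Data.Product using (Σ; _×_; _,_; proj₁; proj₂)
open import Relation.Binary.PropositionalEquality using (_≡_)
open import Relation.Nullary using (¬_)
open import Data.Bool.Properties using (T?)
open import Algebra.Structures using (IsCommutativeRing)
open import Data.Fin.Subset using (Subset)

Bits : ℕ → Set
Bits m = Vec Bool m

_⊕_ : ∀ {m} → Bits m → Bits m → Bits m
_⊕_ = zipWith _xor_

𝟎 : ∀ {m} → Bits m
𝟎 = replicate _ false

-- A field of order 2^n in coordinates w.r.t. a fixed F₂-basis: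
-- a multiplication on F₂^n which, together with coordinatewise addition,
-- makes F₂^n a field.
record GF2Field (n : ℕ) : Set where
  field
    _·_   : Bits n → Bits n → Bits n
    one   : Bits n
    isCommutativeRing : IsCommutativeRing _≡_ _⊕_ _·_ (λ x → x) 𝟎 one
    0≢1   : ¬ (𝟎 ≡ one)
    inverse : ∀ (x : Bits n) → ¬ (x ≡ 𝟎) → Σ (Bits n) (λ y → x · y ≡ one)

allBits : (m : ℕ) → List (Bits m)
allBits ℕ.zero = [] ∷ []
allBits (ℕ.suc m) = concatMap (λ v → (false ∷ v) ∷ (true ∷ v) ∷ []) (allBits m)

count : ∀ {m} → (Bits m → Bool) → Bool → ℕ
count {m} F true  = length (filter (λ z → T? (F z)) (allBits m))
count {m} F false = length (filter (λ z → T? (not (F z))) (allBits m))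

Balanced : ∀ {m} → (Bits m → Bool) → Set
Balanced F = count F true ≡ count F false

dot : ∀ {m} → Bits m → Bits m → Bool
dot u v = foldr _ _xor_ false (zipWith _∧_ u v)

ShiftedBent : ∀ {m} → (Bits m → Bool) → Subset m → Set
ShiftedBent {m} F Λ =
  ∀ (a : Bits m) → ¬ (a ≡ 𝟎) →
    Balanced (λ z → F (z ⊕ a) xor F z xor dot Λ (zipWith _∧_ z a))

component : ∀ {m n} → (Bits m → Bits n) → Bits n → Bits m → Bool
component h c z = dot c (h z)

-- (x,y) ↦ x Π(y) + g(y), with (x,y) written as the coordinate vector x ++ y
mmF : ∀ {n} → GF2Field n → (Bits n → Bits n) → (Bits n → Bits n) → Bits (n + n) → Bits n
mmF {n} K Π g z with splitAt n z
... | x , y , _ = (x · Π y) ⊕ g y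
  where open GF2Field K

-- Λ ⊆ y-indices {n,…,2n-1}, given by Λy ⊆ {0,…,n-1}
yIndices : ∀ {n} → Subset n → Subset (n + n)
yIndices {n} Λy = replicate n false ++ Λy

module Submission where

-- For a direction (a, b) the shifted derivative of (x, y) ↦ c·(xΠ(y) + g(y)) is
-- c·(x(Π(y+b) + Π(y))) plus a term depending on y only.  If Π is a permutation and b ≠ 0,
-- the factor Π(y+b) + Π(y) is nonzero, so for each y the derivative is a nonconstant affine
-- function of x and the character sum over x vanishes; if b = 0 the derivative is c·(aΠ(y)),
-- balanced because y ↦ aΠ(y) is then a permutation.  Conversely the direction (1, 0) has
-- derivative c·Π(y), so every nonzero component of Π is balanced, and by orthogonality of
-- characters  2^n · #Π⁻¹(v) = Σ_c (-1)^(c·v) Σ_y (-1)^(c·Π(y)) = 2^n,  i.e. Π is a permutation.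

open import Defs renaming (_⊕_ to infixl 6 _⊕_)
open import Data.Nat using (ℕ)
open import Data.Product using (_×_; Σ; _,_; proj₁)
open import Data.Fin.Subset using (Subset)
open import Relation.Binary.PropositionalEquality
  using (_≡_; _≢_; refl; sym; trans; cong; cong₂; module ≡-Reasoning)
open import Relation.Nullary using (¬_; yes; no; contradiction)
open import Function.Definitions using (Bijective; Injective; Surjective)

open import Algebra.Bundles using (CommutativeRing)
open import Algebra.Structures using (IsCommutativeRing)
import Algebra.Properties.CommutativeSemigroup as CommutativeSemigroupProperties
open import Data.Bool using (Bool; true; false; _xor_; _∧_; not)
open import Data.Bool.Properties
  using (T?; xor-assoc; xor-same; xor-identityʳ; ∧-distribˡ-xor; ∧-comm; ∧-zeroʳ; xor-∧-commutativeRing)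
  renaming (_≟_ to _≟ᵇ_)
open import Data.Integer using (ℤ; +_; 0ℤ; 1ℤ; -1ℤ; _+_; _*_; _-_; _≤_; +≤+)
import Data.Integer.Properties as ℤ
open import Data.Integer.Tactic.RingSolver using (solve-∀)
open import Data.List using (List; []; _∷_; foldr; length; filter; concatMap)
import Data.Nat as ℕ
import Data.Nat.Properties as ℕ
open import Data.Vec using ([]; _∷_; _++_; zipWith; splitAt)
open import Data.Vec.Properties
  using (≡-dec; ∷-injectiveʳ; zipWith-assoc; zipWith-identityˡ; zipWith-identityʳ; zipWith-zeroʳ; zipWith-++; ++-injectiveˡ)
open import Function.Base using (_∘_)
open import Relation.Binary.Definitions using (DecidableEquality)

open CommutativeSemigroupProperties (CommutativeRing.+-commutativeSemigroup xor-∧-commutativeRing)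
  using () renaming (interchange to xor-interchange)

-- The group (F₂^m, ⊕) and the dot product

_≟_ : ∀ {m} → DecidableEquality (Bits m)
_≟_ = ≡-dec _≟ᵇ_

⊕-assoc : ∀ {m} (u v w : Bits m) → (u ⊕ v) ⊕ w ≡ u ⊕ (v ⊕ w)
⊕-assoc = zipWith-assoc xor-assoc

⊕-identityˡ : ∀ {m} (u : Bits m) → 𝟎 ⊕ u ≡ u
⊕-identityˡ = zipWith-identityˡ (λ _ → refl)

⊕-identityʳ : ∀ {m} (u : Bits m) → u ⊕ 𝟎 ≡ u
⊕-identityʳ = zipWith-identityʳ xor-identityʳ

⊕-self : ∀ {m} (u : Bits m) → u ⊕ u ≡ 𝟎
⊕-self []      = refl
⊕-self (b ∷ u) = cong₂ _∷_ (xor-same b) (⊕-self u)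

⊕-interchange : ∀ {m} (u v w z : Bits m) → (u ⊕ v) ⊕ (w ⊕ z) ≡ (u ⊕ w) ⊕ (v ⊕ z)
⊕-interchange []      []      []      []      = refl
⊕-interchange (a ∷ u) (b ∷ v) (c ∷ w) (d ∷ z) = cong₂ _∷_ (xor-interchange a b c d) (⊕-interchange u v w z)

⊕-cancelʳ : ∀ {m} (u v : Bits m) → (u ⊕ v) ⊕ v ≡ u
⊕-cancelʳ u v = begin
  (u ⊕ v) ⊕ v  ≡⟨ ⊕-assoc u v v ⟩
  u ⊕ (v ⊕ v)  ≡⟨ cong (u ⊕_) (⊕-self v) ⟩
  u ⊕ 𝟎        ≡⟨ ⊕-identityʳ u ⟩
  u            ∎
  where open ≡-Reasoning

⊕-cancelˡ : ∀ {m} (u : Bits m) {v w : Bits m} → u ⊕ v ≡ u ⊕ w → v ≡ w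
⊕-cancelˡ u {v} {w} eq = trans (sym (absorb v)) (trans (cong (u ⊕_) eq) (absorb w))
  where
  open ≡-Reasoning
  absorb : ∀ x → u ⊕ (u ⊕ x) ≡ x
  absorb x = begin
    u ⊕ (u ⊕ x)  ≡⟨ ⊕-assoc u u x ⟨
    (u ⊕ u) ⊕ x  ≡⟨ cong (_⊕ x) (⊕-self u) ⟩
    𝟎 ⊕ x        ≡⟨ ⊕-identityˡ x ⟩
    x            ∎

⊕≡𝟎⇒≡ : ∀ {m} {u v : Bits m} → u ⊕ v ≡ 𝟎 → u ≡ v
⊕≡𝟎⇒≡ {u = u} eq = sym (⊕-cancelˡ u (trans eq (sym (⊕-self u))))

𝟎++𝟎 : ∀ k {l} → 𝟎 {k} ++ 𝟎 {l} ≡ 𝟎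
𝟎++𝟎 ℕ.zero    = refl
𝟎++𝟎 (ℕ.suc k) = cong (false ∷_) (𝟎++𝟎 k)

dot-⊕ : ∀ {m} (c u v : Bits m) → dot c (u ⊕ v) ≡ dot c u xor dot c v
dot-⊕ []       []      []      = refl
dot-⊕ (b ∷ c) (x ∷ u) (y ∷ v) rewrite ∧-distribˡ-xor b x y | dot-⊕ c u v =
  xor-interchange (b ∧ x) (b ∧ y) (dot c u) (dot c v)

dot-comm : ∀ {m} (c u : Bits m) → dot c u ≡ dot u c
dot-comm []      []      = refl
dot-comm (b ∷ c) (x ∷ u) rewrite ∧-comm b x | dot-comm c u = refl

dot-𝟎ˡ : ∀ {m} (u : Bits m) → dot 𝟎 u ≡ false
dot-𝟎ˡ []      = refl
dot-𝟎ˡ (_ ∷ u) = dot-𝟎ˡ u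

dot-𝟎ʳ : ∀ {m} (c : Bits m) → dot c 𝟎 ≡ false
dot-𝟎ʳ c = trans (dot-comm c 𝟎) (dot-𝟎ˡ c)

dot-++ : ∀ {k l} (c u : Bits k) (d v : Bits l) → dot (c ++ d) (u ++ v) ≡ dot c u xor dot d v
dot-++ []      []      d v = refl
dot-++ (b ∷ c) (x ∷ u) d v rewrite dot-++ c u d v = sym (xor-assoc (b ∧ x) (dot c u) (dot d v))

-- Integer-valued sums over F₂^m

∑ : ∀ m → (Bits m → ℤ) → ℤ
∑ ℕ.zero    h = h []
∑ (ℕ.suc m) h = ∑ m (λ v → h (false ∷ v) + h (true ∷ v))

∑-cong : ∀ m {h k : Bits m → ℤ} → (∀ z → h z ≡ k z) → ∑ m h ≡ ∑ m k
∑-cong ℕ.zero    eq = eq []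
∑-cong (ℕ.suc m) eq = ∑-cong m (λ v → cong₂ _+_ (eq (false ∷ v)) (eq (true ∷ v)))

∑-+ : ∀ m (h k : Bits m → ℤ) → ∑ m (λ z → h z + k z) ≡ ∑ m h + ∑ m k
∑-+ ℕ.zero    h k = refl
∑-+ (ℕ.suc m) h k =
  trans (∑-cong m (λ v → interchange (h (false ∷ v)) (k (false ∷ v)) (h (true ∷ v)) (k (true ∷ v))))
        (∑-+ m (λ v → h (false ∷ v) + h (true ∷ v)) (λ v → k (false ∷ v) + k (true ∷ v)))
  where
  interchange : ∀ a b c d → (a + b) + (c + d) ≡ (a + c) + (b + d)
  interchange = solve-∀

∑-*ʳ : ∀ m (h : Bits m → ℤ) (c : ℤ) → ∑ m (λ z → h z * c) ≡ ∑ m h * c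
∑-*ʳ ℕ.zero    h c = refl
∑-*ʳ (ℕ.suc m) h c =
  trans (∑-cong m (λ v → sym (ℤ.*-distribʳ-+ c (h (false ∷ v)) (h (true ∷ v)))))
        (∑-*ʳ m (λ v → h (false ∷ v) + h (true ∷ v)) c)

∑-zero : ∀ m (h : Bits m → ℤ) → (∀ z → h z ≡ 0ℤ) → ∑ m h ≡ 0ℤ
∑-zero ℕ.zero    h eq = eq []
∑-zero (ℕ.suc m) h eq = ∑-zero m _ (λ v → cong₂ _+_ (eq (false ∷ v)) (eq (true ∷ v)))

2^_ : ℕ → ℤ
2^ m = + (2 ℕ.^ m)

∑-const : ∀ m (c : ℤ) → ∑ m (λ _ → c) ≡ c * 2^ m
∑-const ℕ.zero    c = sym (ℤ.*-identityʳ c)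
∑-const (ℕ.suc m) c = begin
  ∑ m (λ _ → c + c)                   ≡⟨ ∑-const m (c + c) ⟩
  (c + c) * 2^ m                      ≡⟨ double c (2^ m) ⟩
  c * (2^ m + 2^ m)                   ≡⟨ cong (c *_) (ℤ.pos-+ (2 ℕ.^ m) (2 ℕ.^ m)) ⟨
  c * + (2 ℕ.^ m ℕ.+ 2 ℕ.^ m)         ≡⟨ cong (λ k → c * + (2 ℕ.^ m ℕ.+ k)) (ℕ.+-identityʳ (2 ℕ.^ m)) ⟨
  c * 2^ ℕ.suc m                      ∎
  where
  open ≡-Reasoning
  double : ∀ c p → (c + c) * p ≡ c * (p + p)
  double = solve-∀

2^-cancelʳ : ∀ m {i j : ℤ} → i * 2^ m ≡ j * 2^ m → i ≡ j
2^-cancelʳ m {i} {j} = ℤ.*-cancelʳ-≡ i j (2^ m) {{ℕ.m^n≢0 2 m}}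

∑-comm : ∀ p q (h : Bits p → Bits q → ℤ) →
         ∑ p (λ x → ∑ q (λ y → h x y)) ≡ ∑ q (λ y → ∑ p (λ x → h x y))
∑-comm ℕ.zero    q h = refl
∑-comm (ℕ.suc p) q h =
  trans (∑-cong p (λ x → sym (∑-+ q (h (false ∷ x)) (h (true ∷ x)))))
        (∑-comm p q (λ x y → h (false ∷ x) y + h (true ∷ x) y))

∑-++ : ∀ p q (h : Bits (p ℕ.+ q) → ℤ) → ∑ (p ℕ.+ q) h ≡ ∑ p (λ x → ∑ q (λ y → h (x ++ y)))
∑-++ ℕ.zero    q h = refl
∑-++ (ℕ.suc p) q h =
  trans (∑-++ p q (λ v → h (false ∷ v) + h (true ∷ v)))
        (∑-cong p (λ x → ∑-+ q (λ y → h (false ∷ x ++ y)) (λ y → h (true ∷ x ++ y))))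

∑-mono-≤ : ∀ m {h k : Bits m → ℤ} → (∀ z → h z ≤ k z) → ∑ m h ≤ ∑ m k
∑-mono-≤ ℕ.zero    le = le []
∑-mono-≤ (ℕ.suc m) le = ∑-mono-≤ m (λ v → ℤ.+-mono-≤ (le (false ∷ v)) (le (true ∷ v)))

∑≢0⇒∃≢0 : ∀ m (h : Bits m → ℤ) → ∑ m h ≢ 0ℤ → Σ (Bits m) (λ z → h z ≢ 0ℤ)
∑≢0⇒∃≢0 ℕ.zero    h ne = [] , ne
∑≢0⇒∃≢0 (ℕ.suc m) h ne with ∑≢0⇒∃≢0 m _ ne
... | v , ne′ with h (false ∷ v) ℤ.≟ 0ℤ
...   | no  ne″ = false ∷ v , ne″
...   | yes eq  = true ∷ v , λ eq′ → ne′ (cong₂ _+_ eq eq′)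

∑-single : ∀ m (h : Bits m → ℤ) (w : Bits m) → (∀ z → z ≢ w → h z ≡ 0ℤ) → ∑ m h ≡ h w
∑-single ℕ.zero    h []          off = refl
∑-single (ℕ.suc m) h (false ∷ w) off =
  trans (∑-single m _ w (λ v v≢w → cong₂ _+_ (off _ (v≢w ∘ ∷-injectiveʳ)) (off _ (v≢w ∘ ∷-injectiveʳ))))
        (trans (cong (_+_ (h (false ∷ w))) (off (true ∷ w) λ ())) (ℤ.+-identityʳ _))
∑-single (ℕ.suc m) h (true ∷ w)  off =
  trans (∑-single m _ w (λ v v≢w → cong₂ _+_ (off _ (v≢w ∘ ∷-injectiveʳ)) (off _ (v≢w ∘ ∷-injectiveʳ))))
        (trans (cong (_+ h (true ∷ w)) (off (false ∷ w) λ ())) (ℤ.+-identityˡ _))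

-- Kronecker delta, fibre sizes and reindexing

δ : ∀ {m} → Bits m → Bits m → ℤ
δ u v with u ≟ v
... | yes _ = 1ℤ
... | no  _ = 0ℤ

δ-refl : ∀ {m} (u : Bits m) → δ u u ≡ 1ℤ
δ-refl u with u ≟ u
... | yes _   = refl
... | no  u≢u = contradiction refl u≢u

δ-≢ : ∀ {m} {u v : Bits m} → u ≢ v → δ u v ≡ 0ℤ
δ-≢ {u = u} {v} u≢v with u ≟ v
... | yes u≡v = contradiction u≡v u≢v
... | no  _   = refl

δ≢0⇒≡ : ∀ {m} {u v : Bits m} → δ u v ≢ 0ℤ → u ≡ v
δ≢0⇒≡ {u = u} {v} δ≢0 with u ≟ v
... | yes u≡v = u≡v
... | no  _   = contradiction refl δ≢0

0≤δ : ∀ {m} (u v : Bits m) → 0ℤ ≤ δ u v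
0≤δ u v with u ≟ v
... | yes _ = +≤+ ℕ.z≤n
... | no  _ = ℤ.≤-refl

∑-δ : ∀ m (w : Bits m) → ∑ m (λ z → δ z w) ≡ 1ℤ
∑-δ m w = trans (∑-single m _ w (λ _ → δ-≢)) (δ-refl w)

∑-δ-* : ∀ m (w : Bits m) (h : Bits m → ℤ) → ∑ m (λ u → δ w u * h u) ≡ h w
∑-δ-* m w h = begin
  ∑ m (λ u → δ w u * h u)  ≡⟨ ∑-single m _ w (λ u u≢w → cong (_* h u) (δ-≢ (u≢w ∘ sym))) ⟩
  δ w w * h w              ≡⟨ cong (_* h w) (δ-refl w) ⟩
  1ℤ * h w                 ≡⟨ ℤ.*-identityˡ (h w) ⟩
  h w                      ∎
  where open ≡-Reasoning

fiberSize : ∀ {m k} → (Bits m → Bits k) → Bits k → ℤ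
fiberSize {m} σ v = ∑ m (λ x → δ (σ x) v)

∑-∘ : ∀ m k (σ : Bits m → Bits k) (h : Bits k → ℤ) →
      ∑ m (λ x → h (σ x)) ≡ ∑ k (λ u → fiberSize σ u * h u)
∑-∘ m k σ h = begin
  ∑ m (λ x → h (σ x))                        ≡⟨ ∑-cong m (λ x → ∑-δ-* k (σ x) h) ⟨
  ∑ m (λ x → ∑ k (λ u → δ (σ x) u * h u))   ≡⟨ ∑-comm m k _ ⟩
  ∑ k (λ u → ∑ m (λ x → δ (σ x) u * h u))   ≡⟨ ∑-cong k (λ u → ∑-*ʳ m (λ x → δ (σ x) u) (h u)) ⟩
  ∑ k (λ u → fiberSize σ u * h u)            ∎
  where open ≡-Reasoning

fiberSize-bijective : ∀ {m} (σ : Bits m → Bits m) → Bijective _≡_ _≡_ σ → ∀ v → fiberSize σ v ≡ 1ℤ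
fiberSize-bijective {m} σ (inj , surj) v with surj v
... | w , σw≡v = begin
  fiberSize σ v  ≡⟨ ∑-single m _ w (λ x x≢w → δ-≢ (λ σx≡v → x≢w (inj (trans σx≡v (sym (σw≡v refl)))))) ⟩
  δ (σ w) v      ≡⟨ cong (λ u → δ u v) (σw≡v refl) ⟩
  δ v v          ≡⟨ δ-refl v ⟩
  1ℤ             ∎
  where open ≡-Reasoning

∑-reindex : ∀ m (σ : Bits m → Bits m) → Bijective _≡_ _≡_ σ → (h : Bits m → ℤ) →
            ∑ m (λ x → h (σ x)) ≡ ∑ m h
∑-reindex m σ σ-bij h = begin
  ∑ m (λ x → h (σ x))              ≡⟨ ∑-∘ m m σ h ⟩
  ∑ m (λ u → fiberSize σ u * h u)  ≡⟨ ∑-cong m (λ u → cong (_* h u) (fiberSize-bijective σ σ-bij u)) ⟩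
  ∑ m (λ u → 1ℤ * h u)             ≡⟨ ∑-cong m (λ u → ℤ.*-identityˡ (h u)) ⟩
  ∑ m h                            ∎
  where open ≡-Reasoning

fiberSize≡1⇒bijective : ∀ {m} (σ : Bits m → Bits m) → (∀ v → fiberSize σ v ≡ 1ℤ) → Bijective _≡_ _≡_ σ
fiberSize≡1⇒bijective {m} σ fiberSize≡1 = injective , surjective
  where
  surjective : Surjective _≡_ _≡_ σ
  surjective v with ∑≢0⇒∃≢0 m (λ x → δ (σ x) v) (λ fiberSize≡0 → case (trans (sym (fiberSize≡1 v)) fiberSize≡0))
    where
    case : 1ℤ ≢ 0ℤ
    case ()
  ... | x , δ≢0 = x , λ { refl → δ≢0⇒≡ δ≢0 }

  injective : Injective _≡_ _≡_ σ
  injective {x} {y} σx≡σy with x ≟ y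
  ... | yes x≡y = x≡y
  ... | no  x≢y = contradiction two≤one λ { (+≤+ (ℕ.s≤s ())) }
    where
    pointwise : ∀ z → δ z x + δ z y ≤ δ (σ z) (σ x)
    pointwise z with z ≟ x | z ≟ y
    ... | yes refl | yes refl = contradiction refl x≢y
    ... | yes refl | no  _    = ℤ.≤-reflexive (sym (δ-refl (σ z)))
    ... | no  _    | yes refl = ℤ.≤-reflexive (sym (trans (cong (δ (σ z)) σx≡σy) (δ-refl (σ z))))
    ... | no  _    | no  _    = 0≤δ (σ z) (σ x)
    open ℤ.≤-Reasoning
    two≤one : + 2 ≤ 1ℤ
    two≤one = begin
      + 2                                     ≡⟨ cong₂ _+_ (∑-δ m x) (∑-δ m y) ⟨
      ∑ m (λ z → δ z x) + ∑ m (λ z → δ z y)   ≡⟨ ∑-+ m _ _ ⟨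
      ∑ m (λ z → δ z x + δ z y)               ≤⟨ ∑-mono-≤ m pointwise ⟩
      fiberSize σ (σ x)                       ≡⟨ fiberSize≡1 (σ x) ⟩
      1ℤ                                      ∎

-- Characters of F₂^m

χ : Bool → ℤ
χ false = 1ℤ
χ true  = -1ℤ

χ-xor : ∀ a b → χ (a xor b) ≡ χ a * χ b
χ-xor false b     = sym (ℤ.*-identityˡ (χ b))
χ-xor true  false = refl
χ-xor true  true  = refl

χ-dot-⊕ : ∀ {m} (c u v : Bits m) → χ (dot c (u ⊕ v)) ≡ χ (dot c u) * χ (dot c v)
χ-dot-⊕ c u v = trans (cong χ (dot-⊕ c u v)) (χ-xor (dot c u) (dot c v))

χ-not : ∀ a → χ a + χ (not a) ≡ 0ℤ
χ-not false = refl
χ-not true  = refl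

∑χ-dot≡0 : ∀ m (c : Bits m) → c ≢ 𝟎 → ∑ m (λ z → χ (dot c z)) ≡ 0ℤ
∑χ-dot≡0 ℕ.zero    []          c≢𝟎 = contradiction refl c≢𝟎
∑χ-dot≡0 (ℕ.suc m) (true ∷ c)  _   = ∑-zero m _ (λ z → χ-not (dot c z))
∑χ-dot≡0 (ℕ.suc m) (false ∷ c) c≢𝟎 =
  trans (∑-+ m _ _) (cong₂ _+_ (∑χ-dot≡0 m c c′≢𝟎) (∑χ-dot≡0 m c c′≢𝟎))
  where
  c′≢𝟎 : c ≢ 𝟎
  c′≢𝟎 c≡𝟎 = c≢𝟎 (cong (false ∷_) c≡𝟎)

∑χ-dot-orthogonal : ∀ m (u v : Bits m) → ∑ m (λ c → χ (dot c (u ⊕ v))) ≡ δ u v * 2^ m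
∑χ-dot-orthogonal m u v with u ≟ v
... | yes refl = begin
  ∑ m (λ c → χ (dot c (u ⊕ u)))  ≡⟨ ∑-cong m (λ c → cong (χ ∘ dot c) (⊕-self u)) ⟩
  ∑ m (λ c → χ (dot c 𝟎))        ≡⟨ ∑-cong m (λ c → cong χ (dot-𝟎ʳ c)) ⟩
  ∑ m (λ _ → 1ℤ)                 ≡⟨ ∑-const m 1ℤ ⟩
  1ℤ * 2^ m                      ∎
  where open ≡-Reasoning
... | no u≢v = begin
  ∑ m (λ c → χ (dot c (u ⊕ v)))  ≡⟨ ∑-cong m (λ c → cong χ (dot-comm c (u ⊕ v))) ⟩
  ∑ m (λ c → χ (dot (u ⊕ v) c))  ≡⟨ ∑χ-dot≡0 m (u ⊕ v) (u≢v ∘ ⊕≡𝟎⇒≡) ⟩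
  0ℤ                             ∎
  where open ≡-Reasoning

-- Balancedness as vanishing of a character sum

listSum : ∀ {m} → (Bits m → ℤ) → List (Bits m) → ℤ
listSum h = foldr (λ z s → h z + s) 0ℤ

listSum-allBits : ∀ m (h : Bits m → ℤ) → listSum h (allBits m) ≡ ∑ m h
listSum-allBits ℕ.zero    h = ℤ.+-identityʳ (h [])
listSum-allBits (ℕ.suc m) h = trans (pairs (allBits m)) (listSum-allBits m _)
  where
  pairs : ∀ L → listSum h (concatMap (λ v → (false ∷ v) ∷ (true ∷ v) ∷ []) L)
              ≡ listSum (λ v → h (false ∷ v) + h (true ∷ v)) L
  pairs []      = refl
  pairs (v ∷ L) rewrite pairs L = sym (ℤ.+-assoc (h (false ∷ v)) (h (true ∷ v)) _)

listSum-χ : ∀ {m} (F : Bits m → Bool) L →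
            listSum (χ ∘ F) L ≡ + length (filter (λ z → T? (not (F z))) L) - + length (filter (λ z → T? (F z)) L)
listSum-χ F []      = refl
listSum-χ F (z ∷ L) with F z
... | true  rewrite listSum-χ F L = addTrue  (+ length (filter (λ z → T? (not (F z))) L)) (+ length (filter (λ z → T? (F z)) L))
  where
  addTrue : ∀ f t → -1ℤ + (f - t) ≡ f - (1ℤ + t)
  addTrue = solve-∀
... | false rewrite listSum-χ F L = addFalse (+ length (filter (λ z → T? (not (F z))) L)) (+ length (filter (λ z → T? (F z)) L))
  where
  addFalse : ∀ f t → 1ℤ + (f - t) ≡ (1ℤ + f) - t
  addFalse = solve-∀

∑χ≡count-difference : ∀ m (F : Bits m → Bool) → ∑ m (χ ∘ F) ≡ + count F false - + count F true
∑χ≡count-difference m F = trans (sym (listSum-allBits m (χ ∘ F))) (listSum-χ F (allBits m))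

balanced⇒∑χ≡0 : ∀ m (F : Bits m → Bool) → Balanced F → ∑ m (χ ∘ F) ≡ 0ℤ
balanced⇒∑χ≡0 m F balanced = begin
  ∑ m (χ ∘ F)                          ≡⟨ ∑χ≡count-difference m F ⟩
  + count F false - + count F true     ≡⟨ cong (λ t → + count F false - + t) balanced ⟩
  + count F false - + count F false    ≡⟨ ℤ.+-inverseʳ (+ count F false) ⟩
  0ℤ                                   ∎
  where open ≡-Reasoning

∑χ≡0⇒balanced : ∀ m (F : Bits m → Bool) → ∑ m (χ ∘ F) ≡ 0ℤ → Balanced F
∑χ≡0⇒balanced m F ∑≡0 =
  sym (ℤ.+-injective (ℤ.i-j≡0⇒i≡j _ _ (trans (sym (∑χ≡count-difference m F)) ∑≡0)))

componentsBalanced⇒bijective : ∀ {m} (σ : Bits m → Bits m) →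
                               (∀ c → c ≢ 𝟎 → Balanced (component σ c)) → Bijective _≡_ _≡_ σ
componentsBalanced⇒bijective {m} σ balanced = fiberSize≡1⇒bijective σ (λ v → 2^-cancelʳ m (scaled v))
  where
  scaled : ∀ v → fiberSize σ v * 2^ m ≡ 1ℤ * 2^ m
  scaled v = begin
    fiberSize σ v * 2^ m                                   ≡⟨ ∑-*ʳ m (λ y → δ (σ y) v) (2^ m) ⟨
    ∑ m (λ y → δ (σ y) v * 2^ m)                           ≡⟨ ∑-cong m (λ y → ∑χ-dot-orthogonal m (σ y) v) ⟨
    ∑ m (λ y → ∑ m (λ c → χ (dot c (σ y ⊕ v))))            ≡⟨ ∑-comm m m _ ⟩
    ∑ m (λ c → ∑ m (λ y → χ (dot c (σ y ⊕ v))))            ≡⟨ ∑-cong m (λ c → ∑-cong m (λ y → χ-dot-⊕ c (σ y) v)) ⟩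
    ∑ m (λ c → ∑ m (λ y → χ (dot c (σ y)) * χ (dot c v)))  ≡⟨ ∑-cong m (λ c → ∑-*ʳ m _ (χ (dot c v))) ⟩
    ∑ m (λ c → ∑ m (χ ∘ component σ c) * χ (dot c v))      ≡⟨ ∑-single m _ 𝟎 vanishes-off-𝟎 ⟩
    ∑ m (χ ∘ component σ 𝟎) * χ (dot 𝟎 v)                  ≡⟨ cong₂ _*_ (∑-cong m (λ y → cong χ (dot-𝟎ˡ (σ y)))) (cong χ (dot-𝟎ˡ v)) ⟩
    ∑ m (λ _ → 1ℤ) * 1ℤ                                     ≡⟨ ℤ.*-identityʳ _ ⟩
    ∑ m (λ _ → 1ℤ)                                          ≡⟨ ∑-const m 1ℤ ⟩
    1ℤ * 2^ m                                               ∎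
    where
    open ≡-Reasoning
    vanishes-off-𝟎 : ∀ c → c ≢ 𝟎 → ∑ m (χ ∘ component σ c) * χ (dot c v) ≡ 0ℤ
    vanishes-off-𝟎 c c≢𝟎 = cong (_* χ (dot c v)) (balanced⇒∑χ≡0 m _ (balanced c c≢𝟎))

-- The Maiorana–McFarland construction

module _ {n} (K : GF2Field n) where
  open GF2Field K using (one; inverse) renaming (_·_ to infixl 7 _·_)
  open IsCommutativeRing (GF2Field.isCommutativeRing K) using (*-assoc; *-comm; *-identityˡ)

  ·-bijective : ∀ {d} → d ≢ 𝟎 → Bijective _≡_ _≡_ (d ·_)
  ·-bijective {d} d≢𝟎 with inverse d d≢𝟎
  ... | e , d·e≡one = injective , surjective
    where
    open ≡-Reasoning
    cancel : ∀ x → e · (d · x) ≡ x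
    cancel x = begin
      e · (d · x)  ≡⟨ *-assoc e d x ⟨
      e · d · x    ≡⟨ cong (_· x) (trans (*-comm e d) d·e≡one) ⟩
      one · x      ≡⟨ *-identityˡ x ⟩
      x            ∎
    injective : Injective _≡_ _≡_ (d ·_)
    injective {x} {x′} eq = trans (sym (cancel x)) (trans (cong (e ·_) eq) (cancel x′))
    surjective : Surjective _≡_ _≡_ (d ·_)
    surjective u = e · u , λ { refl → begin
      d · (e · u)  ≡⟨ *-assoc d e u ⟨
      d · e · u    ≡⟨ cong (_· u) d·e≡one ⟩
      one · u      ≡⟨ *-identityˡ u ⟩
      u            ∎ }

  ∑χ-dot-·≡0 : ∀ {c d} → c ≢ 𝟎 → d ≢ 𝟎 → ∑ n (λ x → χ (dot c (d · x))) ≡ 0ℤ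
  ∑χ-dot-·≡0 {c} {d} c≢𝟎 d≢𝟎 = trans (∑-reindex n (d ·_) (·-bijective d≢𝟎) (χ ∘ dot c)) (∑χ-dot≡0 n c c≢𝟎)

-- ShiftedBent F Λ unfolds to  ∀ a → a ≢ 𝟎 → Balanced (Δ F Λ a).
Δ : ∀ {m} → (Bits m → Bool) → Subset m → Bits m → Bits m → Bool
Δ F Λ a z = F (z ⊕ a) xor F z xor dot Λ (zipWith _∧_ z a)

splitAt-++ : ∀ {k l} (x : Bits k) (y : Bits l) → splitAt k (x ++ y) ≡ (x , y , refl)
splitAt-++ []      y = refl
splitAt-++ (b ∷ x) y rewrite splitAt-++ x y = refl

module _ {n} (K : GF2Field n) (Π g : Bits n → Bits n) where
  open GF2Field K using (one; 0≢1; isCommutativeRing) renaming (_·_ to infixl 7 _·_)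
  open IsCommutativeRing isCommutativeRing using (*-comm; *-identityˡ; distribˡ; distribʳ; zeroʳ)

  mmF-++ : ∀ x y → mmF K Π g (x ++ y) ≡ x · Π y ⊕ g y
  mmF-++ x y rewrite splitAt-++ x y = refl

  mmF-difference : ∀ a b x y → mmF K Π g ((x ⊕ a) ++ (y ⊕ b)) ⊕ mmF K Π g (x ++ y)
                             ≡ x · (Π (y ⊕ b) ⊕ Π y) ⊕ (a · Π (y ⊕ b) ⊕ g (y ⊕ b) ⊕ g y)
  mmF-difference a b x y = begin
    mmF K Π g ((x ⊕ a) ++ (y ⊕ b)) ⊕ mmF K Π g (x ++ y)  ≡⟨ cong₂ _⊕_ (mmF-++ (x ⊕ a) (y ⊕ b)) (mmF-++ x y) ⟩
    ((x ⊕ a) · p′ ⊕ g′) ⊕ (x · p ⊕ g y)                   ≡⟨ cong (λ t → t ⊕ g′ ⊕ (x · p ⊕ g y)) (distribʳ p′ x a) ⟩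
    (x · p′ ⊕ a · p′ ⊕ g′) ⊕ (x · p ⊕ g y)                ≡⟨ cong (_⊕ (x · p ⊕ g y)) (⊕-assoc (x · p′) (a · p′) g′) ⟩
    (x · p′ ⊕ (a · p′ ⊕ g′)) ⊕ (x · p ⊕ g y)              ≡⟨ ⊕-interchange (x · p′) (a · p′ ⊕ g′) (x · p) (g y) ⟩
    (x · p′ ⊕ x · p) ⊕ (a · p′ ⊕ g′ ⊕ g y)                ≡⟨ cong (_⊕ (a · p′ ⊕ g′ ⊕ g y)) (distribˡ x p′ p) ⟨
    x · (p′ ⊕ p) ⊕ (a · p′ ⊕ g′ ⊕ g y)                    ∎
    where
    open ≡-Reasoning
    p p′ g′ : Bits n
    p  = Π y
    p′ = Π (y ⊕ b)
    g′ = g (y ⊕ b)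

  module _ (c : Bits n) (Λy : Subset n) where
    private
      F : Bits (n ℕ.+ n) → Bool
      F = component (mmF K Π g) c

    Δ-mmF : ∀ a b x y → Δ F (yIndices Λy) (a ++ b) (x ++ y)
            ≡ dot c (x · (Π (y ⊕ b) ⊕ Π y)) xor dot c (a · Π (y ⊕ b) ⊕ g (y ⊕ b) ⊕ g y) xor dot Λy (zipWith _∧_ y b)
    Δ-mmF a b x y = begin
      F ((x ++ y) ⊕ (a ++ b)) xor F (x ++ y) xor dot (yIndices Λy) (zipWith _∧_ (x ++ y) (a ++ b))
        ≡⟨ cong₂ (λ s t → F s xor F (x ++ y) xor dot (yIndices Λy) t) (zipWith-++ _xor_ x y a b) (zipWith-++ _∧_ x y a b) ⟩
      F ((x ⊕ a) ++ (y ⊕ b)) xor F (x ++ y) xor dot (𝟎 ++ Λy) (zipWith _∧_ x a ++ zipWith _∧_ y b)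
        ≡⟨ xor-assoc (F ((x ⊕ a) ++ (y ⊕ b))) (F (x ++ y)) _ ⟨
      (F ((x ⊕ a) ++ (y ⊕ b)) xor F (x ++ y)) xor dot (𝟎 ++ Λy) (zipWith _∧_ x a ++ zipWith _∧_ y b)
        ≡⟨ cong₂ _xor_ (sym (dot-⊕ c shifted unshifted)) (dot-++ 𝟎 (zipWith _∧_ x a) Λy (zipWith _∧_ y b)) ⟩
      dot c (shifted ⊕ unshifted) xor (dot 𝟎 (zipWith _∧_ x a) xor L)
        ≡⟨ cong₂ (λ s t → dot c s xor (t xor L)) (mmF-difference a b x y) (dot-𝟎ˡ (zipWith _∧_ x a)) ⟩
      dot c (x · d ⊕ e) xor L
        ≡⟨ cong (_xor L) (dot-⊕ c (x · d) e) ⟩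
      (dot c (x · d) xor dot c e) xor L
        ≡⟨ xor-assoc (dot c (x · d)) (dot c e) L ⟩
      dot c (x · d) xor dot c e xor L
        ∎
      where
      open ≡-Reasoning
      shifted unshifted d e : Bits n
      shifted   = mmF K Π g ((x ⊕ a) ++ (y ⊕ b))
      unshifted = mmF K Π g (x ++ y)
      d         = Π (y ⊕ b) ⊕ Π y
      e         = a · Π (y ⊕ b) ⊕ g (y ⊕ b) ⊕ g y
      L : Bool
      L = dot Λy (zipWith _∧_ y b)

    Δ-mmF-x-shift : ∀ a x y → Δ F (yIndices Λy) (a ++ 𝟎) (x ++ y) ≡ dot c (a · Π y)
    Δ-mmF-x-shift a x y = begin
      Δ F (yIndices Λy) (a ++ 𝟎) (x ++ y)
        ≡⟨ Δ-mmF a 𝟎 x y ⟩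
      dot c (x · (Π (y ⊕ 𝟎) ⊕ Π y)) xor dot c (a · Π (y ⊕ 𝟎) ⊕ g (y ⊕ 𝟎) ⊕ g y) xor dot Λy (zipWith _∧_ y 𝟎)
        ≡⟨ cong (λ t → dot c (x · (Π t ⊕ Π y)) xor dot c (a · Π t ⊕ g t ⊕ g y) xor dot Λy (zipWith _∧_ y 𝟎)) (⊕-identityʳ y) ⟩
      dot c (x · (Π y ⊕ Π y)) xor dot c (a · Π y ⊕ g y ⊕ g y) xor dot Λy (zipWith _∧_ y 𝟎)
        ≡⟨ cong₂ (λ s t → dot c (x · s) xor dot c t xor dot Λy (zipWith _∧_ y 𝟎)) (⊕-self (Π y)) (⊕-cancelʳ (a · Π y) (g y)) ⟩
      dot c (x · 𝟎) xor dot c (a · Π y) xor dot Λy (zipWith _∧_ y 𝟎)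
        ≡⟨ cong₂ (λ s t → dot c s xor dot c (a · Π y) xor dot Λy t) (zeroʳ x) (zipWith-zeroʳ ∧-zeroʳ y) ⟩
      dot c 𝟎 xor dot c (a · Π y) xor dot Λy 𝟎
        ≡⟨ cong₂ (λ s t → s xor dot c (a · Π y) xor t) (dot-𝟎ʳ c) (dot-𝟎ʳ Λy) ⟩
      dot c (a · Π y) xor false
        ≡⟨ xor-identityʳ (dot c (a · Π y)) ⟩
      dot c (a · Π y)
        ∎
      where open ≡-Reasoning

    ∑χΔ-y-shift≡0 : Injective _≡_ _≡_ Π → c ≢ 𝟎 → ∀ a {b} → b ≢ 𝟎 →
                    ∑ n (λ x → ∑ n (λ y → χ (Δ F (yIndices Λy) (a ++ b) (x ++ y)))) ≡ 0ℤ
    ∑χΔ-y-shift≡0 Π-inj c≢𝟎 a {b} b≢𝟎 = trans (∑-comm n n _) (∑-zero n _ ∑ₓ≡0)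
      where
      ∑ₓ≡0 : ∀ y → ∑ n (λ x → χ (Δ F (yIndices Λy) (a ++ b) (x ++ y))) ≡ 0ℤ
      ∑ₓ≡0 y = begin
        ∑ n (λ x → χ (Δ F (yIndices Λy) (a ++ b) (x ++ y)))
          ≡⟨ ∑-cong n (λ x → trans (cong χ (Δ-mmF a b x y)) (χ-xor (dot c (x · d)) e)) ⟩
        ∑ n (λ x → χ (dot c (x · d)) * χ e)
          ≡⟨ ∑-*ʳ n (λ x → χ (dot c (x · d))) (χ e) ⟩
        ∑ n (λ x → χ (dot c (x · d))) * χ e
          ≡⟨ cong (_* χ e) (∑-cong n (λ x → cong (χ ∘ dot c) (*-comm x d))) ⟩
        ∑ n (λ x → χ (dot c (d · x))) * χ e
          ≡⟨ cong (_* χ e) (∑χ-dot-·≡0 K c≢𝟎 d≢𝟎) ⟩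
        0ℤ
          ∎
        where
        open ≡-Reasoning
        d : Bits n
        d = Π (y ⊕ b) ⊕ Π y
        e : Bool
        e = dot c (a · Π (y ⊕ b) ⊕ g (y ⊕ b) ⊕ g y) xor dot Λy (zipWith _∧_ y b)
        d≢𝟎 : d ≢ 𝟎
        d≢𝟎 d≡𝟎 = b≢𝟎 (⊕-cancelˡ y (trans (Π-inj (⊕≡𝟎⇒≡ d≡𝟎)) (sym (⊕-identityʳ y))))

    ∑χΔ-x-shift≡0 : Bijective _≡_ _≡_ Π → c ≢ 𝟎 → ∀ {a} → a ≢ 𝟎 →
                    ∑ n (λ x → ∑ n (λ y → χ (Δ F (yIndices Λy) (a ++ 𝟎) (x ++ y)))) ≡ 0ℤ
    ∑χΔ-x-shift≡0 Π-bij c≢𝟎 {a} a≢𝟎 = ∑-zero n _ λ x → begin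
      ∑ n (λ y → χ (Δ F (yIndices Λy) (a ++ 𝟎) (x ++ y)))  ≡⟨ ∑-cong n (λ y → cong χ (Δ-mmF-x-shift a x y)) ⟩
      ∑ n (λ y → χ (dot c (a · Π y)))                      ≡⟨ ∑-reindex n Π Π-bij (λ u → χ (dot c (a · u))) ⟩
      ∑ n (λ u → χ (dot c (a · u)))                        ≡⟨ ∑χ-dot-·≡0 K c≢𝟎 a≢𝟎 ⟩
      0ℤ                                                   ∎
      where open ≡-Reasoning

    bijective⇒shiftedBent : Bijective _≡_ _≡_ Π → c ≢ 𝟎 → ShiftedBent F (yIndices Λy)
    bijective⇒shiftedBent Π-bij c≢𝟎 w w≢𝟎 with splitAt n w
    ... | a , b , refl = ∑χ≡0⇒balanced (n ℕ.+ n) _ (trans (∑-++ n n _) (∑χΔ≡0 a b w≢𝟎))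
      where
      ∑χΔ≡0 : ∀ a b → a ++ b ≢ 𝟎 → ∑ n (λ x → ∑ n (λ y → χ (Δ F (yIndices Λy) (a ++ b) (x ++ y)))) ≡ 0ℤ
      ∑χΔ≡0 a b a++b≢𝟎 with b ≟ 𝟎
      ... | no  b≢𝟎 = ∑χΔ-y-shift≡0 (proj₁ Π-bij) c≢𝟎 a b≢𝟎
      ... | yes refl = ∑χΔ-x-shift≡0 Π-bij c≢𝟎 (λ a≡𝟎 → a++b≢𝟎 (trans (cong (_++ 𝟎) a≡𝟎) (𝟎++𝟎 n)))

    shiftedBent⇒componentBalanced : ShiftedBent F (yIndices Λy) → Balanced (component Π c)
    shiftedBent⇒componentBalanced bent = ∑χ≡0⇒balanced n (component Π c) (2^-cancelʳ n (begin
      ∑ n (χ ∘ component Π c) * 2^ n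
        ≡⟨ ∑-const n _ ⟨
      ∑ n (λ x → ∑ n (χ ∘ component Π c))
        ≡⟨ ∑-cong n (λ x → ∑-cong n (λ y → cong χ (Δ-one y x))) ⟨
      ∑ n (λ x → ∑ n (λ y → χ (Δ F (yIndices Λy) (one ++ 𝟎) (x ++ y))))
        ≡⟨ ∑-++ n n _ ⟨
      ∑ (n ℕ.+ n) (χ ∘ Δ F (yIndices Λy) (one ++ 𝟎))
        ≡⟨ balanced⇒∑χ≡0 (n ℕ.+ n) _ (bent (one ++ 𝟎) one++𝟎≢𝟎) ⟩
      0ℤ * 2^ n
        ∎))
      where
      open ≡-Reasoning
      Δ-one : ∀ y x → Δ F (yIndices Λy) (one ++ 𝟎) (x ++ y) ≡ component Π c y
      Δ-one y x = trans (Δ-mmF-x-shift one x y) (cong (dot c) (*-identityˡ (Π y)))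
      one++𝟎≢𝟎 : one ++ 𝟎 ≢ 𝟎
      one++𝟎≢𝟎 eq = 0≢1 (sym (++-injectiveˡ one 𝟎 (trans eq (sym (𝟎++𝟎 n)))))

corollary5p2 : (n : ℕ) (K : GF2Field n) (Π g : Bits n → Bits n) (Λy : Subset n) →
    ((∀ (c : Bits n) → ¬ (c ≡ 𝟎) → ShiftedBent (component (mmF K Π g) c) (yIndices Λy))
      → Bijective _≡_ _≡_ Π)
    × (Bijective _≡_ _≡_ Π
      → ∀ (c : Bits n) → ¬ (c ≡ 𝟎) → ShiftedBent (component (mmF K Π g) c) (yIndices Λy))
corollary5p2 n K Π g Λy =
    (λ bent → componentsBalanced⇒bijective Π (λ c c≢𝟎 → shiftedBent⇒componentBalanced K Π g c Λy (bent c c≢𝟎)))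
  , (λ Π-bij c c≢𝟎 → bijective⇒shiftedBent K Π g c Λy Π-bij c≢𝟎)
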